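{- Let $k\geq 1$, let $P_{2k+1}$ be the path with $2k+1$ vertices and let $H$ be a graph. Then the lexicographic product $P_{2k+1}[H]$ is traceable if and only if $(k+1)\pi(H)\geq |H|-1$ (equivalently, when $\pi(H)\geq 1$, $\left\lceil\frac{|H|-1}{\pi(H)}\right\rceil\leq k+1$).
   Context: The lexicographic product $G[H]$ has vertex set $V(G)\times V(H)$, with $(g,h)(g',h')$ an edge iff $gg'\in E(G)$, or $g=g'$ and $hh'\in E(H)$. $|H|$ is the number of vertices of $H$. $\pi(H)$ is the maximum number of edges of a spanning linear forest of $H$ (a forest whose components are paths). A graph is traceable if it has a hamiltonian path. -}

module Defs where

open import Data.Nat using (ℕ; zero; suc; _+_; _∸_; _≤_)
open import Data.Fin using (Fin; toℕ)
open import Data.Product using (_×_; _,_; Σ; ∃-syntax)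
open import Data.Sum using (_⊎_)
open import Data.List using (List; []; _∷_; length; concat; map)
open import Data.Nat.ListAction using (sum)
open import Data.List.Relation.Unary.All using (All)
open import Data.List.Relation.Unary.Unique.Propositional using (Unique)
open import Data.List.Membership.Propositional using (_∈_)
open import Relation.Binary.PropositionalEquality using (_≡_)
open import Relation.Nullary using (¬_; Dec)

record Graph (n : ℕ) : Set₁ where
  field
    Adj    : Fin n → Fin n → Set
    adj?   : ∀ u v → Dec (Adj u v)
    sym    : ∀ {u v} → Adj u v → Adj v u
    irrefl : ∀ {u} → ¬ Adj u u
open Graph public

order : ∀ {n} → Graph n → ℕ
order {n} _ = n

data IsWalk {V : Set} (R : V → V → Set) : List V → Set where
  []  : IsWalk R []
  [_] : ∀ v → IsWalk R (v ∷ [])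
  _∷_ : ∀ {u v vs} → R u v → IsWalk R (v ∷ vs) → IsWalk R (u ∷ v ∷ vs)

Spanning : {V : Set} → List V → Set
Spanning {V} xs = Unique xs × (∀ (v : V) → v ∈ xs)

HamPath : {V : Set} → (V → V → Set) → List V → Set
HamPath R xs = IsWalk R xs × Spanning xs

TraceableRel : {V : Set} → (V → V → Set) → Set
TraceableRel R = ∃[ xs ] HamPath R xs

PathAdj : (m : ℕ) → Fin m → Fin m → Set
PathAdj m i j = (toℕ j ≡ suc (toℕ i)) ⊎ (toℕ i ≡ suc (toℕ j))

LexPathAdj : ∀ (m : ℕ) {n} → Graph n → (Fin m × Fin n) → (Fin m × Fin n) → Set
LexPathAdj m H (g , h) (g' , h') = PathAdj m g g' ⊎ (g ≡ g' × Adj H h h')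

record LinearForest {n} (H : Graph n) : Set where
  field
    paths    : List (List (Fin n))
    nonempty : All (λ p → ¬ p ≡ []) paths
    walks    : All (IsWalk (Adj H)) paths
    spanning : Spanning (concat paths)
open LinearForest public

edgesLF : ∀ {n} {H : Graph n} → LinearForest H → ℕ
edgesLF F = sum (map (λ p → length p ∸ 1) (paths F))

IsPi : ∀ {n} → Graph n → ℕ → Set
IsPi H p = Σ (LinearForest H) (λ F → edgesLF F ≡ p) × (∀ (F : LinearForest H) → edgesLF F ≤ p)

module Submission where

-- The layers {i} × H of P_{2k+1}[H] are copies of H, and consecutive layers are completely joined.
--
-- Necessity: along a hamiltonian path, every vertex of an even layer except the first one is entered
-- either from the same layer or from an odd layer.  The edges inside one even layer form a spanning
-- linear forest of H, and distinct vertices are entered from distinct odd vertices, so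
-- (k+1)|H| ≤ (k+1)π(H) + k|H| + 1.
--
-- Sufficiency: take a maximum linear forest of H (π(H) edges, b + 1 = |H| − π(H) paths) in every even
-- layer and cut it into pieces, which are then separated by single odd-layer vertices.  The k|H| odd
-- vertices must separate k|H| + 1 pieces in total, while one layer yields between b + 1 and |H| pieces;
-- (k+1)π(H) ≥ |H| − 1 is exactly the condition that this is possible.

open import Defs hiding (sym)
open import Data.Nat using (ℕ; zero; suc; _+_; _*_; _∸_; _≤_; _≥_; _<_; z≤n; s≤s; _⊓_; NonZero)
open import Data.Nat.DivMod using (_mod_; m<n⇒m%n≡m)
open import Data.Nat.Properties
open import Data.Nat.ListAction using (sum)
open import Data.Nat.Tactic.RingSolver using (solve-∀)
open import Data.Fin as Fin using (Fin; toℕ; fromℕ<)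
import Data.Fin.Properties as Finₚ
open import Data.Product using (∃; ∃₂; _×_; _,_; proj₁; proj₂; uncurry)
open import Data.Sum using (_⊎_; inj₁; inj₂)
open import Data.Empty using (⊥-elim)
open import Data.Unit using (⊤)
open import Data.List
  using (List; []; _∷_; _++_; length; map; concat; take; drop; tabulate; allFin; cartesianProduct)
open import Data.List.Properties
  using ( length-++; length-++-sucʳ; length-map; length-take; length-drop; length-tabulate
        ; ++-identityʳ; take++drop≡id; concat-map)
open import Data.List.Relation.Unary.All as All using (All; []; _∷_)
import Data.List.Relation.Unary.All.Properties as Allₚ
open import Data.List.Relation.Unary.Any using (here; there)
open import Data.List.Relation.Unary.Unique.Propositional using (Unique; []; _∷_)
import Data.List.Relation.Unary.Unique.Propositional.Properties as Uniqueₚ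
open import Data.List.Relation.Binary.Subset.Propositional using (_⊆_)
open import Data.List.Membership.Propositional using (_∈_; _∉_)
open import Data.List.Membership.Propositional.Properties
open import Function.Base using (id; _∘_)
open import Function.Bundles using (_⇔_; mk⇔)
open import Relation.Binary.PropositionalEquality
open import Relation.Nullary using (¬_; Dec; yes; no; contradiction)

module _ {A : Set} where

  ∈-++-insert : ∀ xs {ys} {x v : A} → v ∈ xs ++ ys → v ∈ xs ++ x ∷ ys
  ∈-++-insert xs p with ∈-++⁻ xs p
  ... | inj₁ q = ∈-++⁺ˡ q
  ... | inj₂ q = ∈-++⁺ʳ xs (there q)

  Unique-remove : ∀ xs {ys} {x : A} → Unique (xs ++ x ∷ ys) → x ∉ xs ++ ys × Unique (xs ++ ys)
  Unique-remove [] (x∉ ∷ u) = Allₚ.All¬⇒¬Any x∉ , u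
  Unique-remove (y ∷ xs) {ys} {x} (y∉ ∷ u) with Unique-remove xs u
  ... | x∉ , u′ = x∉y∷ , All.tabulate (λ q → All.lookup y∉ (∈-++-insert xs q)) ∷ u′
    where
    x∉y∷ : x ∉ y ∷ xs ++ ys
    x∉y∷ (here x≡y) = All.lookup y∉ (∈-++⁺ʳ xs (here refl)) (sym x≡y)
    x∉y∷ (there q) = x∉ q

  Unique⇒length≤ : ∀ {xs ys : List A} → Unique xs → xs ⊆ ys → length xs ≤ length ys
  Unique⇒length≤ [] _ = z≤n
  Unique⇒length≤ {x ∷ xs} (x∉ ∷ u) sub with ∈-∃++ (sub (here refl))
  ... | ys₁ , ys₂ , refl =
    subst (suc (length xs) ≤_) (sym (length-++-sucʳ ys₁ x ys₂)) (s≤s (Unique⇒length≤ u sub′))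
    where
    sub′ : xs ⊆ ys₁ ++ ys₂
    sub′ q with ∈-++⁻ ys₁ (sub (there q))
    ... | inj₁ r = ∈-++⁺ˡ r
    ... | inj₂ (here refl) = ⊥-elim (All.lookup x∉ q refl)
    ... | inj₂ (there r) = ∈-++⁺ʳ ys₁ r

  length≤⇒Unique : ∀ {xs ys : List A} → Unique ys → ys ⊆ xs → xs ⊆ ys → length xs ≤ length ys → Unique xs
  length≤⇒Unique {[]} _ _ _ _ = []
  length≤⇒Unique {x ∷ xs} u ys⊆ ⊆ys len with ∈-∃++ (⊆ys (here refl))
  ... | ys₁ , ys₂ , refl =
    Allₚ.¬Any⇒All¬ xs x∉xs ∷ length≤⇒Unique u′ ys′⊆ ⊆ys′ len′
    where
    x∉ys′ = proj₁ (Unique-remove ys₁ u)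
    u′ = proj₂ (Unique-remove ys₁ u)
    x∉xs : x ∉ xs
    x∉xs x∈xs = <⇒≱ len (Unique⇒length≤ u ys⊆xs)
      where
      ys⊆xs : ys₁ ++ x ∷ ys₂ ⊆ xs
      ys⊆xs q with ys⊆ q
      ... | here refl = x∈xs
      ... | there r = r
    ys′⊆ : ys₁ ++ ys₂ ⊆ xs
    ys′⊆ q with ys⊆ (∈-++-insert ys₁ q)
    ... | here refl = ⊥-elim (x∉ys′ q)
    ... | there r = r
    ⊆ys′ : xs ⊆ ys₁ ++ ys₂
    ⊆ys′ q with ∈-++⁻ ys₁ (⊆ys (there q))
    ... | inj₁ r = ∈-++⁺ˡ r
    ... | inj₂ (here refl) = ⊥-elim (x∉xs q)
    ... | inj₂ (there r) = ∈-++⁺ʳ ys₁ r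
    len′ : length xs ≤ length (ys₁ ++ ys₂)
    len′ = ≤-pred (subst (suc (length xs) ≤_) (length-++-sucʳ ys₁ x ys₂) len)

Unique⇒length≤n : ∀ {n} {xs : List (Fin n)} → Unique xs → length xs ≤ n
Unique⇒length≤n {n} {xs} u =
  subst (length xs ≤_) (length-tabulate {n = n} id) (Unique⇒length≤ u (λ {v} _ → ∈-allFin v))

covering⇒n≤length : ∀ {n} {xs : List (Fin n)} → (∀ v → v ∈ xs) → n ≤ length xs
covering⇒n≤length {n} {xs} covers =
  subst (_≤ length xs) (length-tabulate {n = n} id) (Unique⇒length≤ (Uniqueₚ.allFin⁺ n) (λ {v} _ → covers v))

length-Spanning : ∀ {n} {xs : List (Fin n)} → Spanning xs → length xs ≡ n
length-Spanning (u , covers) = ≤-antisym (Unique⇒length≤n u) (covering⇒n≤length covers)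

𝟙 : {P : Set} → Dec P → ℕ
𝟙 (yes _) = 1
𝟙 (no _) = 0

𝟙-yes : ∀ {P : Set} (d : Dec P) → P → 𝟙 d ≡ 1
𝟙-yes (yes _) _ = refl
𝟙-yes (no ¬p) p = contradiction p ¬p

𝟙-no : ∀ {P : Set} (d : Dec P) → ¬ P → 𝟙 d ≡ 0
𝟙-no (yes p) ¬p = contradiction p ¬p
𝟙-no (no _) _ = refl

∑< : ℕ → (ℕ → ℕ) → ℕ
∑< zero f = 0
∑< (suc K) f = ∑< K f + f K

syntax ∑< K (λ j → e) = ∑[ j < K ] e

∑-distrib-+ : ∀ K (f g : ℕ → ℕ) → ∑[ j < K ] (f j + g j) ≡ ∑[ j < K ] f j + ∑[ j < K ] g j
∑-distrib-+ zero f g = refl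
∑-distrib-+ (suc K) f g rewrite ∑-distrib-+ K f g = shuffle (∑< K f) (∑< K g) (f K) (g K)
  where
  shuffle : ∀ a b c d → a + b + (c + d) ≡ a + c + (b + d)
  shuffle = solve-∀

∑-mono-≤ : ∀ K {f g : ℕ → ℕ} → (∀ {j} → j < K → f j ≤ g j) → ∑[ j < K ] f j ≤ ∑[ j < K ] g j
∑-mono-≤ zero f≤g = z≤n
∑-mono-≤ (suc K) f≤g = +-mono-≤ (∑-mono-≤ K (λ j<K → f≤g (m≤n⇒m≤1+n j<K))) (f≤g ≤-refl)

∑-const : ∀ K c → ∑[ j < K ] c ≡ K * c
∑-const zero c = refl
∑-const (suc K) c = trans (cong (_+ c) (∑-const K c)) (+-comm (K * c) c)

∑-term : ∀ K (f : ℕ → ℕ) {j} → j < K → f j ≤ ∑[ i < K ] f i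
∑-term (suc K) f {j} j<1+K with j ≟ K
... | yes refl = m≤n+m (f K) _
... | no j≢K = ≤-trans (∑-term K f (≤∧≢⇒< (≤-pred j<1+K) j≢K)) (m≤m+n _ (f K))

module _ (g : ℕ → ℕ) (g-injective : ∀ {i j} → g i ≡ g j → i ≡ j) where

  ∑𝟙-miss : ∀ K l → (∀ {j} → j < K → l ≢ g j) → ∑[ j < K ] 𝟙 (l ≟ g j) ≡ 0
  ∑𝟙-miss zero l miss = refl
  ∑𝟙-miss (suc K) l miss rewrite ∑𝟙-miss K l (λ j<K → miss (m≤n⇒m≤1+n j<K)) = 𝟙-no (l ≟ g K) (miss ≤-refl)

  ∑𝟙≤1 : ∀ K l → ∑[ j < K ] 𝟙 (l ≟ g j) ≤ 1
  ∑𝟙≤1 zero l = z≤n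
  ∑𝟙≤1 (suc K) l with l ≟ g K
  ... | no _ = ≤-trans (≤-reflexive (+-identityʳ _)) (∑𝟙≤1 K l)
  ... | yes refl = ≤-reflexive (cong (_+ 1) (∑𝟙-miss K (g K) (λ j<K eq → <-irrefl (sym (g-injective eq)) j<K)))

  ∑𝟙-hit : ∀ K {j} → j < K → 1 ≤ ∑[ i < K ] 𝟙 (g j ≟ g i)
  ∑𝟙-hit K {j} j<K = ≤-trans (≤-reflexive (sym (𝟙-yes (g j ≟ g j) refl))) (∑-term K (λ i → 𝟙 (g j ≟ g i)) j<K)

data Parity : ℕ → Set where
  even : ∀ j → Parity (2 * j)
  odd  : ∀ j → Parity (suc (2 * j))

parity : ∀ l → Parity l
parity zero = even 0
parity (suc l) with parity l
... | even j = odd j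
... | odd j = subst Parity (*-suc 2 j) (even (suc j))

2*-injective : ∀ {i j} → 2 * i ≡ 2 * j → i ≡ j
2*-injective {i} {j} = *-cancelˡ-≡ i j 2

1+2*-injective : ∀ {i j} → suc (2 * i) ≡ suc (2 * j) → i ≡ j
1+2*-injective eq = 2*-injective (suc-injective eq)

2*m<1+2*n⇒m<1+n : ∀ {m n} → 2 * m < suc (2 * n) → m < suc n
2*m<1+2*n⇒m<1+n lt = s≤s (*-cancelˡ-≤ 2 (≤-pred lt))

1+2*m<1+2*n⇒m<n : ∀ {m n} → suc (2 * m) < suc (2 * n) → m < n
1+2*m<1+2*n⇒m<n {m} {n} lt = *-cancelˡ-< 2 m n (≤-pred lt)

2+m+2*n≡m+2*[1+n] : ∀ m n → suc (suc m) + 2 * n ≡ m + 2 * suc n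
2+m+2*n≡m+2*[1+n] m n = trans (sym (+-suc (suc m) (2 * n))) (trans (sym (+-suc m (suc (2 * n)))) (cong (m +_) (sym (*-suc 2 n))))

links : {A : Set} → List A → List (A × A)
links (x ∷ y ∷ xs) = (x , y) ∷ links (y ∷ xs)
links _ = []

module _ {A : Set} {R : A → A → Set} (P : A → Set) (e o : A → ℕ) (s : A → A → ℕ)
         (e≤1 : ∀ {x} → P x → e x ≤ 1)
         (charge : ∀ {x y} → P x → P y → R x y → e y ≤ s x y + o x) where

  -- Every vertex but the first is paid for by the link from its predecessor.
  walk-charging : ∀ {xs} → IsWalk R xs → All P xs →
                  sum (map e xs) ≤ sum (map (uncurry s) (links xs)) + sum (map o xs) + 1
  walk-charging {[]} _ _ = z≤n
  walk-charging {x ∷ xs} w (px ∷ pxs) = ≤-trans (from x w (px ∷ pxs)) (+-monoʳ-≤ _ (e≤1 px))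
    where
    from : ∀ x {xs} → IsWalk R (x ∷ xs) → All P (x ∷ xs) →
           sum (map e (x ∷ xs)) ≤ sum (map (uncurry s) (links (x ∷ xs))) + sum (map o (x ∷ xs)) + e x
    from x [ .x ] _ = ≤-trans (≤-reflexive (+-identityʳ (e x))) (m≤n+m (e x) _)
    from x {y ∷ ys} (r ∷ w) (px ∷ py ∷ pys) = begin
      e x + E                         ≤⟨ +-monoʳ-≤ (e x) (from y w (py ∷ pys)) ⟩
      e x + (S + O + e y)             ≤⟨ +-monoʳ-≤ (e x) (+-monoʳ-≤ (S + O) (charge px py r)) ⟩
      e x + (S + O + (s x y + o x))   ≡⟨ shuffle (e x) S O (s x y) (o x) ⟩
      s x y + S + (o x + O) + e x     ∎
      where
      open ≤-Reasoning
      E = sum (map e (y ∷ ys))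
      S = sum (map (uncurry s) (links (y ∷ ys)))
      O = sum (map o (y ∷ ys))
      shuffle : ∀ a b c d f → a + (b + c + (d + f)) ≡ d + b + (f + c) + a
      shuffle = solve-∀

sum-∑-comm : ∀ {A : Set} K (f : ℕ → A → ℕ) (xs : List A) →
             sum (map (λ x → ∑[ j < K ] f j x) xs) ≡ ∑[ j < K ] sum (map (f j) xs)
sum-∑-comm K f [] = sym (trans (∑-const K 0) (*-zeroʳ K))
sum-∑-comm K f (x ∷ xs) =
  trans (cong (∑[ j < K ] f j x +_) (sum-∑-comm K f xs)) (sym (∑-distrib-+ K (λ j → f j x) (λ j → sum (map (f j) xs))))

IsWalk-map : ∀ {A B : Set} {R : A → A → Set} {S : B → B → Set} {P : A → Set} (f : A → B) →
             (∀ {x y} → P x → P y → R x y → S (f x) (f y)) → ∀ {xs} → IsWalk R xs → All P xs → IsWalk S (map f xs)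
IsWalk-map f pres [] _ = []
IsWalk-map f pres [ x ] _ = [ f x ]
IsWalk-map f pres (r ∷ w) (px ∷ pys@(py ∷ _)) = pres px py r ∷ IsWalk-map f pres w pys

length-cartesianProduct : ∀ {A B : Set} (xs : List A) (ys : List B) →
                          length (cartesianProduct xs ys) ≡ length xs * length ys
length-cartesianProduct [] ys = refl
length-cartesianProduct (x ∷ xs) ys =
  trans (length-++ (map (x ,_) ys)) (cong₂ _+_ (length-map (x ,_) ys) (length-cartesianProduct xs ys))

pathEdges : {A : Set} → List (List A) → ℕ
pathEdges ps = sum (map (λ p → length p ∸ 1) ps)

NonEmpty : {A : Set} → List A → Set
NonEmpty xs = ¬ xs ≡ []

close : {A : Set} → List A → List (List A) → List (List A)
close [] ps = ps
close (x ∷ xs) ps = (x ∷ xs) ∷ ps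

module _ {A : Set} where

  concat-close : ∀ (xs : List A) ps → concat (close xs ps) ≡ xs ++ concat ps
  concat-close [] ps = refl
  concat-close (x ∷ xs) ps = refl

  All-close : ∀ {P : List A → Set} xs {ps} → (NonEmpty xs → P xs) → All P ps → All P (close xs ps)
  All-close [] _ ps = ps
  All-close (x ∷ xs) p ps = p (λ ()) ∷ ps

  𝟙⁺ : List A → ℕ
  𝟙⁺ [] = 0
  𝟙⁺ (_ ∷ _) = 1

  pathEdges-close : ∀ (xs : List A) ps → length xs + pathEdges ps ≡ 𝟙⁺ xs + pathEdges (close xs ps)
  pathEdges-close [] ps = refl
  pathEdges-close (x ∷ xs) ps = refl

module _ {A : Set} where

  splitPaths : ℕ → List (List A) → List (List A)
  splitPaths zero ps = ps
  splitPaths (suc d) [] = []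
  splitPaths (suc d) ([] ∷ ps) = [] ∷ splitPaths (suc d) ps
  splitPaths (suc d) ((x ∷ []) ∷ ps) = (x ∷ []) ∷ splitPaths (suc d) ps
  splitPaths (suc d) ((x ∷ y ∷ xs) ∷ ps) = (x ∷ []) ∷ splitPaths d ((y ∷ xs) ∷ ps)

  concat-splitPaths : ∀ d (ps : List (List A)) → concat (splitPaths d ps) ≡ concat ps
  concat-splitPaths zero ps = refl
  concat-splitPaths (suc d) [] = refl
  concat-splitPaths (suc d) ([] ∷ ps) = concat-splitPaths (suc d) ps
  concat-splitPaths (suc d) ((x ∷ []) ∷ ps) = cong (x ∷_) (concat-splitPaths (suc d) ps)
  concat-splitPaths (suc d) ((x ∷ y ∷ xs) ∷ ps) = cong (x ∷_) (concat-splitPaths d ((y ∷ xs) ∷ ps))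

  All-splitPaths : ∀ {P : List A → Set} → (∀ {x} → P (x ∷ [])) → (∀ {x y xs} → P (x ∷ y ∷ xs) → P (y ∷ xs)) →
                   ∀ d {ps} → All P ps → All P (splitPaths d ps)
  All-splitPaths single tail zero ps = ps
  All-splitPaths single tail (suc d) [] = []
  All-splitPaths single tail (suc d) {[] ∷ _} (p ∷ ps) = p ∷ All-splitPaths single tail (suc d) ps
  All-splitPaths single tail (suc d) {(x ∷ []) ∷ _} (p ∷ ps) = p ∷ All-splitPaths single tail (suc d) ps
  All-splitPaths single tail (suc d) {(x ∷ y ∷ xs) ∷ _} (p ∷ ps) = single ∷ All-splitPaths single tail d (tail p ∷ ps)

  length-splitPaths : ∀ d {ps : List (List A)} → All NonEmpty ps → d ≤ pathEdges ps →
                      length (splitPaths d ps) ≡ length ps + d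
  length-splitPaths zero {ps} _ _ = sym (+-identityʳ (length ps))
  length-splitPaths (suc d) {[] ∷ _} (ne ∷ _) _ = contradiction refl ne
  length-splitPaths (suc d) {(x ∷ []) ∷ _} (_ ∷ nes) d≤ = cong suc (length-splitPaths (suc d) nes d≤)
  length-splitPaths (suc d) {(x ∷ y ∷ xs) ∷ ps} (_ ∷ nes) (s≤s d≤) =
    cong suc (trans (length-splitPaths d ((λ ()) ∷ nes) d≤) (sym (+-suc (length ps) d)))

  pathEdges+length : ∀ {ps : List (List A)} → All NonEmpty ps → pathEdges ps + length ps ≡ length (concat ps)
  pathEdges+length [] = refl
  pathEdges+length {[] ∷ _} (ne ∷ _) = contradiction refl ne
  pathEdges+length {(x ∷ xs) ∷ ps} (_ ∷ nes) = begin
    length xs + pathEdges ps + suc (length ps)  ≡⟨ +-suc _ (length ps) ⟩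
    suc (length xs + pathEdges ps + length ps)  ≡⟨ cong suc (+-assoc (length xs) _ _) ⟩
    suc (length xs + (pathEdges ps + length ps)) ≡⟨ cong (λ m → suc (length xs + m)) (pathEdges+length nes) ⟩
    suc (length xs + length (concat ps))        ≡⟨ cong suc (sym (length-++ xs)) ⟩
    length ((x ∷ xs) ++ concat ps)              ∎
    where open ≡-Reasoning

  interleave : List (List A) → List A → List A
  interleave [] os = os
  interleave (c ∷ cs) [] = c ++ concat cs
  interleave (c ∷ cs) (o ∷ os) = c ++ o ∷ interleave cs os

  length-interleave : ∀ cs os → length (interleave cs os) ≡ length (concat cs) + length os
  length-interleave [] os = refl
  length-interleave (c ∷ cs) [] = sym (+-identityʳ _)
  length-interleave (c ∷ cs) (o ∷ os) = begin
    length (c ++ o ∷ interleave cs os)                     ≡⟨ length-++ c ⟩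
    length c + suc (length (interleave cs os))             ≡⟨ cong (λ m → length c + suc m) (length-interleave cs os) ⟩
    length c + suc (length (concat cs) + length os)        ≡⟨ shuffle (length c) (length (concat cs)) (length os) ⟩
    length c + length (concat cs) + suc (length os)        ≡⟨ cong (_+ suc (length os)) (sym (length-++ c)) ⟩
    length (c ++ concat cs) + suc (length os)              ∎
    where
    open ≡-Reasoning
    shuffle : ∀ a b c → a + suc (b + c) ≡ a + b + suc c
    shuffle = solve-∀

  ∈-interleave⁺ˡ : ∀ {x} cs os → x ∈ concat cs → x ∈ interleave cs os
  ∈-interleave⁺ˡ (c ∷ cs) [] p = p
  ∈-interleave⁺ˡ (c ∷ cs) (o ∷ os) p with ∈-++⁻ c p
  ... | inj₁ q = ∈-++⁺ˡ q
  ... | inj₂ q = ∈-++⁺ʳ c (there (∈-interleave⁺ˡ cs os q))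

  ∈-interleave⁺ʳ : ∀ {x} cs os → x ∈ os → x ∈ interleave cs os
  ∈-interleave⁺ʳ [] os p = p
  ∈-interleave⁺ʳ (c ∷ cs) (o ∷ os) (here refl) = ∈-++⁺ʳ c (here refl)
  ∈-interleave⁺ʳ (c ∷ cs) (o ∷ os) (there p) = ∈-++⁺ʳ c (there (∈-interleave⁺ʳ cs os p))

  All-interleave : ∀ {P : A → Set} cs os → All P (concat cs) → All P os → All P (interleave cs os)
  All-interleave [] os _ pos = pos
  All-interleave (c ∷ cs) [] pcs _ = pcs
  All-interleave (c ∷ cs) (o ∷ os) pcs (po ∷ pos) with Allₚ.++⁻ c pcs
  ... | pc , pcs′ = Allₚ.++⁺ pc (po ∷ All-interleave cs os pcs′ pos)

data Walk {A : Set} (R : A → A → Set) : A → A → List A → Set where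
  [_] : ∀ x → Walk R x x (x ∷ [])
  _∷_ : ∀ {x y z xs} → R x y → Walk R y z (y ∷ xs) → Walk R x z (x ∷ y ∷ xs)

module _ {A : Set} {R : A → A → Set} where

  Walk⇒IsWalk : ∀ {a b xs} → Walk R a b xs → IsWalk R xs
  Walk⇒IsWalk [ x ] = [ x ]
  Walk⇒IsWalk (r ∷ w) = r ∷ Walk⇒IsWalk w

  Walk-∷ : ∀ {x a b ys} → R x a → Walk R a b ys → Walk R x b (x ∷ ys)
  Walk-∷ r w@([ _ ]) = r ∷ w
  Walk-∷ r w@(_ ∷ _) = r ∷ w

  Walk-++ : ∀ {a b c d xs ys} → Walk R a b xs → R b c → Walk R c d ys → Walk R a d (xs ++ ys)
  Walk-++ [ a ] r w = Walk-∷ r w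
  Walk-++ (r′ ∷ w′) r w = r′ ∷ Walk-++ w′ r w

  WalkBetween : (A → Set) → List A → Set
  WalkBetween P xs = ∃₂ λ a b → P a × P b × Walk R a b xs

  interleave-walk : ∀ {P Q : A → Set} → (∀ {u v} → P u → Q v → R u v) → (∀ {u v} → Q u → P v → R u v) →
                    ∀ cs os → All (WalkBetween P) cs → All Q os → length cs ≡ suc (length os) →
                    WalkBetween P (interleave cs os)
  interleave-walk PQ QP (c ∷ []) [] (wc ∷ []) [] _ = subst (WalkBetween _) (sym (++-identityʳ c)) wc
  interleave-walk PQ QP (c ∷ c′ ∷ cs) (o ∷ os) ((a , b , pa , pb , w) ∷ wcs) (qo ∷ qos) len
    with interleave-walk PQ QP (c′ ∷ cs) os wcs qos (suc-injective len)
  ... | a′ , b′ , pa′ , pb′ , w′ = a , b′ , pa , pb′ , Walk-++ w (PQ pb qo) (Walk-∷ (QP qo pa′) w′)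

Consecutive : ℕ → ℕ → Set
Consecutive l l′ = l′ ≡ suc l ⊎ l ≡ suc l′

Consecutive-sym : ∀ {l l′} → Consecutive l l′ → Consecutive l′ l
Consecutive-sym (inj₁ eq) = inj₂ eq
Consecutive-sym (inj₂ eq) = inj₁ eq

module Layered {n : ℕ} (H : Graph n) where

  V : Set
  V = ℕ × Fin n

  layer : V → ℕ
  layer = proj₁

  -- ℕ[H], the lexicographic product of the one-way infinite path with H; P_M[H] is its first M layers.
  LexAdj : V → V → Set
  LexAdj (l , h) (l′ , h′) = Consecutive l l′ ⊎ (l ≡ l′ × Adj H h h′)

  LexAdj-sameLayer : ∀ {l h h′} → LexAdj (l , h) (l , h′) → Adj H h h′
  LexAdj-sameLayer (inj₁ (inj₁ l≡1+l)) = contradiction (sym l≡1+l) 1+n≢n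
  LexAdj-sameLayer (inj₁ (inj₂ l≡1+l)) = contradiction (sym l≡1+l) 1+n≢n
  LexAdj-sameLayer (inj₂ (_ , a)) = a

  record StripWalk (M : ℕ) (ys : List V) : Set where
    field
      walk     : IsWalk LexAdj ys
      bounded  : All (λ v → layer v < M) ys
      covering : ∀ {l} h → l < M → (l , h) ∈ ys

  𝟙-layer : ℕ → V → ℕ
  𝟙-layer L x = 𝟙 (layer x ≟ L)

  module Layer (L : ℕ) where

    lay : List V → List (Fin n)
    lay [] = []
    lay ((l , h) ∷ xs) with l ≟ L
    ... | yes _ = h ∷ lay xs
    ... | no _ = lay xs

    layerEdges : List V → ℕ
    layerEdges xs = sum (map (uncurry λ x y → 𝟙-layer L x * 𝟙-layer L y) (links xs))

    startsInLayer : List V → ℕ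
    startsInLayer [] = 0
    startsInLayer (x ∷ _) = 𝟙-layer L x

    layerEdges-∷ : ∀ x xs → layerEdges (x ∷ xs) ≡ 𝟙-layer L x * startsInLayer xs + layerEdges xs
    layerEdges-∷ x [] = cong (_+ 0) (sym (*-zeroʳ (𝟙-layer L x)))
    layerEdges-∷ x (y ∷ xs) = refl

    length-lay : ∀ xs → length (lay xs) ≡ sum (map (𝟙-layer L) xs)
    length-lay [] = refl
    length-lay ((l , h) ∷ xs) with l ≟ L
    ... | yes _ = cong suc (length-lay xs)
    ... | no _ = length-lay xs

    ∈-lay⁻ : ∀ {h} xs → h ∈ lay xs → (L , h) ∈ xs
    ∈-lay⁻ ((l , h) ∷ xs) p with l ≟ L
    ∈-lay⁻ ((l , h) ∷ xs) (here refl) | yes refl = here refl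
    ∈-lay⁻ ((l , h) ∷ xs) (there p) | yes _ = there (∈-lay⁻ xs p)
    ... | no _ = there (∈-lay⁻ xs p)

    ∈-lay⁺ : ∀ {h} xs → (L , h) ∈ xs → h ∈ lay xs
    ∈-lay⁺ ((l , h) ∷ xs) p with l ≟ L
    ∈-lay⁺ ((l , h) ∷ xs) (here refl) | yes _ = here refl
    ∈-lay⁺ ((l , h) ∷ xs) (there p) | yes _ = there (∈-lay⁺ xs p)
    ∈-lay⁺ ((l , h) ∷ xs) (here refl) | no l≢L = contradiction refl l≢L
    ∈-lay⁺ ((l , h) ∷ xs) (there p) | no _ = ∈-lay⁺ xs p

    Unique-lay : ∀ {xs} → Unique xs → Unique (lay xs)
    Unique-lay {[]} [] = []
    Unique-lay {(l , h) ∷ xs} (x∉ ∷ u) with l ≟ L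
    ... | yes refl = All.tabulate (λ p h≡ → All.lookup x∉ (∈-lay⁻ xs p) (cong (L ,_) h≡)) ∷ Unique-lay u
    ... | no _ = Unique-lay u

    scan : List V → List (Fin n) × List (List (Fin n))
    scan [] = [] , []
    scan ((l , h) ∷ xs) with l ≟ L
    ... | yes _ = (h ∷ proj₁ (scan xs)) , proj₂ (scan xs)
    ... | no _ = [] , uncurry close (scan xs)

    runs : List V → List (List (Fin n))
    runs xs = uncurry close (scan xs)

    concat-runs : ∀ xs → concat (runs xs) ≡ lay xs
    concat-runs xs = trans (concat-close (proj₁ (scan xs)) _) (scanned xs)
      where
      scanned : ∀ xs → proj₁ (scan xs) ++ concat (proj₂ (scan xs)) ≡ lay xs
      scanned [] = refl
      scanned ((l , h) ∷ xs) with l ≟ L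
      ... | yes _ = cong (h ∷_) (scanned xs)
      ... | no _ = concat-runs xs

    runs-NonEmpty : ∀ xs → All NonEmpty (runs xs)
    runs-NonEmpty xs = All-close (proj₁ (scan xs)) id (rest xs)
      where
      rest : ∀ xs → All NonEmpty (proj₂ (scan xs))
      rest [] = []
      rest ((l , h) ∷ xs) with l ≟ L
      ... | yes _ = rest xs
      ... | no _ = runs-NonEmpty xs

    startsInLayer-scan : ∀ xs → startsInLayer xs ≡ 𝟙⁺ (proj₁ (scan xs))
    startsInLayer-scan [] = refl
    startsInLayer-scan ((l , h) ∷ xs) with l ≟ L
    ... | yes _ = refl
    ... | no _ = refl

    pathEdges-runs : ∀ xs → pathEdges (runs xs) ≡ layerEdges xs
    pathEdges-runs [] = refl
    pathEdges-runs ((l , h) ∷ xs) with l ≟ L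
    ... | no l≢L = begin
      pathEdges (runs xs)                     ≡⟨ pathEdges-runs xs ⟩
      0 * startsInLayer xs + layerEdges xs    ≡⟨ cong (λ c → c * startsInLayer xs + layerEdges xs) (sym (𝟙-no (l ≟ L) l≢L)) ⟩
      𝟙-layer L (l , h) * startsInLayer xs + layerEdges xs ≡⟨ sym (layerEdges-∷ (l , h) xs) ⟩
      layerEdges ((l , h) ∷ xs)               ∎
      where open ≡-Reasoning
    ... | yes l≡L = begin
      length front + pathEdges rest        ≡⟨ pathEdges-close front rest ⟩
      𝟙⁺ front + pathEdges (runs xs)        ≡⟨ cong₂ _+_ (sym (startsInLayer-scan xs)) (pathEdges-runs xs) ⟩
      startsInLayer xs + layerEdges xs      ≡⟨ cong (_+ layerEdges xs) (sym (+-identityʳ (startsInLayer xs))) ⟩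
      1 * startsInLayer xs + layerEdges xs  ≡⟨ cong (λ c → c * startsInLayer xs + layerEdges xs) (sym (𝟙-yes (l ≟ L) l≡L)) ⟩
      𝟙-layer L (l , h) * startsInLayer xs + layerEdges xs ≡⟨ sym (layerEdges-∷ (l , h) xs) ⟩
      layerEdges ((l , h) ∷ xs)             ∎
      where
      open ≡-Reasoning
      front = proj₁ (scan xs)
      rest = proj₂ (scan xs)

    scan-front : ∀ x xs {c cs} → proj₁ (scan (x ∷ xs)) ≡ c ∷ cs → x ≡ (L , c)
    scan-front (l , h) xs eq with l ≟ L
    scan-front (l , h) xs refl | yes refl = refl
    scan-front (l , h) xs () | no _

    runs-walks : ∀ {xs} → IsWalk LexAdj xs → All (IsWalk (Adj H)) (runs xs)
    runs-walks w = uncurry (λ wf → All-close _ (λ _ → wf)) (scanned w)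
      where
      extend : ∀ {h} y ys → (∀ {c} → y ≡ (L , c) → Adj H h c) →
               IsWalk (Adj H) (proj₁ (scan (y ∷ ys))) → IsWalk (Adj H) (h ∷ proj₁ (scan (y ∷ ys)))
      extend {h} y ys adj w with proj₁ (scan (y ∷ ys)) in eq
      ... | [] = [ h ]
      ... | c ∷ cs = adj (scan-front y ys eq) ∷ w

      scanned : ∀ {xs} → IsWalk LexAdj xs → IsWalk (Adj H) (proj₁ (scan xs)) × All (IsWalk (Adj H)) (proj₂ (scan xs))
      scanned [] = [] , []
      scanned [ l , h ] with l ≟ L
      ... | yes _ = [ h ] , []
      ... | no _ = [] , []
      scanned {(l , h) ∷ y ∷ ys} (r ∷ w) with scanned w | l ≟ L
      ... | wf , wr | yes refl = extend y ys (λ { refl → LexAdj-sameLayer r }) wf , wr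
      ... | wf , wr | no _ = [] , All-close _ (λ _ → wf) wr

    forest : ∀ {xs} → IsWalk LexAdj xs → Unique xs → (∀ h → (L , h) ∈ xs) → LinearForest H
    forest {xs} w u covers = record
      { paths = runs xs
      ; nonempty = runs-NonEmpty xs
      ; walks = runs-walks w
      ; spanning = subst Spanning (sym (concat-runs xs)) (Unique-lay u , λ h → ∈-lay⁺ xs (covers h))
      }

    layerEdges≤π : ∀ {p xs} → IsPi H p → IsWalk LexAdj xs → Unique xs → (∀ h → (L , h) ∈ xs) → layerEdges xs ≤ p
    layerEdges≤π {p} {xs} (_ , maximal) w u covers =
      subst (_≤ p) (pathEdges-runs xs) (maximal (forest w u covers))

    covering⇒n≤ : ∀ {xs} → (∀ h → (L , h) ∈ xs) → n ≤ sum (map (𝟙-layer L) xs)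
    covering⇒n≤ {xs} covers = subst (n ≤_) (length-lay xs) (covering⇒n≤length (λ h → ∈-lay⁺ xs (covers h)))

    Unique⇒≤n : ∀ {xs} → Unique xs → sum (map (𝟙-layer L) xs) ≤ n
    Unique⇒≤n {xs} u = subst (_≤ n) (length-lay xs) (Unique⇒length≤n (Unique-lay u))

  module _ (k : ℕ) where

    Bounded : V → Set
    Bounded x = layer x < suc (2 * k)

    evenLayer oddLayer : V → ℕ
    evenLayer x = ∑[ j < suc k ] 𝟙-layer (2 * j) x
    oddLayer x = ∑[ j < k ] 𝟙-layer (suc (2 * j)) x

    sameEvenLayer : V → V → ℕ
    sameEvenLayer x y = ∑[ j < suc k ] (𝟙-layer (2 * j) x * 𝟙-layer (2 * j) y)

    evenLayer≤1 : ∀ x → evenLayer x ≤ 1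
    evenLayer≤1 x = ∑𝟙≤1 (2 *_) 2*-injective (suc k) (layer x)

    oddLayer-hit : ∀ {j} h → j < k → 1 ≤ oddLayer (suc (2 * j) , h)
    oddLayer-hit h = ∑𝟙-hit (λ i → suc (2 * i)) 1+2*-injective k

    sameEvenLayer-hit : ∀ {j} h h′ → j < suc k → 1 ≤ sameEvenLayer (2 * j , h) (2 * j , h′)
    sameEvenLayer-hit {j} h h′ j<1+k = ≤-trans (≤-reflexive (sym one)) (∑-term (suc k) _ j<1+k)
      where
      one : 𝟙 (2 * j ≟ 2 * j) * 𝟙 (2 * j ≟ 2 * j) ≡ 1
      one rewrite 𝟙-yes (2 * j ≟ 2 * j) refl = refl

    even-charge : ∀ {lx hx hy} j → Bounded (lx , hx) → Bounded (2 * j , hy) → LexAdj (lx , hx) (2 * j , hy) →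
                1 ≤ sameEvenLayer (lx , hx) (2 * j , hy) + oddLayer (lx , hx)
    even-charge {hx = hx} {hy} j _ by (inj₂ (refl , _)) =
      ≤-trans (sameEvenLayer-hit {j} hx hy (2*m<1+2*n⇒m<1+n by)) (m≤m+n _ (oddLayer (2 * j , hx)))
    even-charge {hx = hx} {hy} j bx _ (inj₁ (inj₂ refl)) =
      ≤-trans (oddLayer-hit {j} hx (1+2*m<1+2*n⇒m<n bx)) (m≤n+m _ (sameEvenLayer (suc (2 * j) , hx) (2 * j , hy)))
    even-charge {lx} {hx} {hy} (suc j) _ by (inj₁ (inj₁ 2+2j≡1+lx)) =
      ≤-trans (subst (λ l → 1 ≤ oddLayer (l , hx)) lx≡ (oddLayer-hit {j} hx (≤-pred (2*m<1+2*n⇒m<1+n by))))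
              (m≤n+m _ (sameEvenLayer (lx , hx) (2 * suc j , hy)))
      where
      lx≡ = suc-injective (trans (sym (*-suc 2 j)) 2+2j≡1+lx)

    charge : ∀ {x y} → Bounded x → Bounded y → LexAdj x y → evenLayer y ≤ sameEvenLayer x y + oddLayer x
    charge {lx , hx} {ly , hy} bx by adj with parity ly
    ... | odd j = ≤-trans (≤-reflexive noEven) z≤n
      where
      noEven : evenLayer (suc (2 * j) , hy) ≡ 0
      noEven = ∑𝟙-miss (2 *_) 2*-injective (suc k) (suc (2 * j)) (λ {i} _ eq → even≢odd i j (sym eq))
    ... | even j = ≤-trans (evenLayer≤1 (2 * j , hy)) (even-charge j bx by adj)

    strip-necessity : ∀ {p xs} → IsPi H p → StripWalk (suc (2 * k)) xs → Unique xs → n ∸ 1 ≤ suc k * p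
    strip-necessity {p} {xs} π strip u =
      subst (n ∸ 1 ≤_) (m+n∸n≡m (suc k * p) 1) (∸-monoˡ-≤ 1 (+-cancelʳ-≤ (k * n) n (suc k * p + 1) counted′))
      where
      open ≤-Reasoning
      open StripWalk strip renaming (walk to w; covering to covers)
      covers-even : ∀ {j} → j < suc k → ∀ h → (2 * j , h) ∈ xs
      covers-even j<1+k h = covers h (s≤s (*-monoʳ-≤ 2 (≤-pred j<1+k)))
      charged : sum (map evenLayer xs) ≤ sum (map (uncurry sameEvenLayer) (links xs)) + sum (map oddLayer xs) + 1
      charged = walk-charging Bounded evenLayer oddLayer sameEvenLayer (λ {x} _ → evenLayer≤1 x) charge w bounded
      by-layer : sum (map (uncurry sameEvenLayer) (links xs)) + sum (map oddLayer xs)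
               ≡ ∑[ j < suc k ] Layer.layerEdges (2 * j) xs + ∑[ j < k ] sum (map (𝟙-layer (suc (2 * j))) xs)
      by-layer = cong₂ _+_
        (sum-∑-comm (suc k) (λ j → uncurry λ x y → 𝟙-layer (2 * j) x * 𝟙-layer (2 * j) y) (links xs))
        (sum-∑-comm k (λ j → 𝟙-layer (suc (2 * j))) xs)
      counted : suc k * n ≤ suc k * p + k * n + 1
      counted = begin
        suc k * n                                         ≡⟨ sym (∑-const (suc k) n) ⟩
        ∑[ j < suc k ] n                                  ≤⟨ ∑-mono-≤ (suc k) (λ j<1+k → Layer.covering⇒n≤ _ (covers-even j<1+k)) ⟩
        ∑[ j < suc k ] sum (map (𝟙-layer (2 * j)) xs)     ≡⟨ sym (sum-∑-comm (suc k) (λ j → 𝟙-layer (2 * j)) xs) ⟩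
        sum (map evenLayer xs)                            ≤⟨ charged ⟩
        sum (map (uncurry sameEvenLayer) (links xs)) + sum (map oddLayer xs) + 1  ≡⟨ cong (_+ 1) by-layer ⟩
        ∑[ j < suc k ] Layer.layerEdges (2 * j) xs + ∑[ j < k ] sum (map (𝟙-layer (suc (2 * j))) xs) + 1
          ≤⟨ +-monoˡ-≤ 1 (+-mono-≤ (∑-mono-≤ (suc k) (λ j<1+k → Layer.layerEdges≤π _ π w u (covers-even j<1+k)))
                                   (∑-mono-≤ k (λ _ → Layer.Unique⇒≤n _ u))) ⟩
        ∑[ j < suc k ] p + ∑[ j < k ] n + 1               ≡⟨ cong₂ (λ a b → a + b + 1) (∑-const (suc k) p) (∑-const k n) ⟩
        suc k * p + k * n + 1                             ∎
      counted′ : n + k * n ≤ suc k * p + 1 + k * n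
      counted′ = subst (n + k * n ≤_) (rearrange (suc k * p) (k * n)) counted
        where
        rearrange : ∀ a b → a + b + 1 ≡ a + 1 + b
        rearrange = solve-∀

  module _ {M : ℕ} where

    embed : Fin M × Fin n → V
    embed (g , h) = toℕ g , h

    traceable⇒StripWalk : TraceableRel (LexPathAdj M H) → ∃ λ ys → StripWalk M ys × Unique ys
    traceable⇒StripWalk (xs , w , u , covers) = map embed xs , strip , Uniqueₚ.map⁺ embed-injective u
      where
      embed-injective : ∀ {x y} → embed x ≡ embed y → x ≡ y
      embed-injective eq = cong₂ _,_ (Finₚ.toℕ-injective (cong proj₁ eq)) (cong proj₂ eq)
      embed-adj : ∀ {x y} → LexPathAdj M H x y → LexAdj (embed x) (embed y)
      embed-adj (inj₁ q) = inj₁ q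
      embed-adj (inj₂ (refl , a)) = inj₂ (refl , a)
      strip : StripWalk M (map embed xs)
      strip = record
        { walk = IsWalk-map {P = λ _ → ⊤} embed (λ _ _ → embed-adj) w (All.universal _ xs)
        ; bounded = Allₚ.map⁺ (All.universal (λ x → Finₚ.toℕ<n (proj₁ x)) xs)
        ; covering = λ h l<M → subst (λ l → (l , h) ∈ map embed xs) (Finₚ.toℕ-fromℕ< l<M)
                                      (∈-map⁺ embed (covers (fromℕ< l<M , h)))
        }

    module _ .{{_ : NonZero M}} where

      toℕ-mod : ∀ {l} → l < M → toℕ (l mod M) ≡ l
      toℕ-mod {l} l<M = trans (Finₚ.toℕ-fromℕ< _) (m<n⇒m%n≡m l<M)

      project : V → Fin M × Fin n
      project (l , h) = l mod M , h

      StripWalk⇒traceable : ∀ {ys} → StripWalk M ys → length ys ≤ M * n → TraceableRel (LexPathAdj M H)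
      StripWalk⇒traceable {ys} strip len =
        map project ys , path , length≤⇒Unique all-unique (λ {v} _ → covers v) (λ {v} _ → all-∋ v) len′ , covers
        where
        open StripWalk strip
        all = cartesianProduct (allFin M) (allFin n)
        all-unique = Uniqueₚ.cartesianProduct⁺ (Uniqueₚ.allFin⁺ M) (Uniqueₚ.allFin⁺ n)
        all-∋ : ∀ v → v ∈ all
        all-∋ (g , h) = ∈-cartesianProduct⁺ (∈-allFin g) (∈-allFin h)
        project-adj : ∀ {x y} → layer x < M → layer y < M → LexAdj x y → LexPathAdj M H (project x) (project y)
        project-adj bx by (inj₁ (inj₁ eq)) = inj₁ (inj₁ (trans (toℕ-mod by) (trans eq (cong suc (sym (toℕ-mod bx))))))
        project-adj bx by (inj₁ (inj₂ eq)) = inj₁ (inj₂ (trans (toℕ-mod bx) (trans eq (cong suc (sym (toℕ-mod by))))))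
        project-adj bx by (inj₂ (refl , a)) = inj₂ (refl , a)
        path : IsWalk (LexPathAdj M H) (map project ys)
        path = IsWalk-map project project-adj walk bounded
        covers : ∀ v → v ∈ map project ys
        covers (g , h) = subst (λ g′ → (g′ , h) ∈ map project ys) (Finₚ.toℕ-injective (toℕ-mod (Finₚ.toℕ<n g)))
                               (∈-map⁺ project (covering h (Finₚ.toℕ<n g)))
        all-length : M * n ≡ length all
        all-length = sym (trans (length-cartesianProduct (allFin M) (allFin n))
                                (cong₂ _*_ (length-tabulate {n = M} id) (length-tabulate {n = n} id)))
        len′ : length (map project ys) ≤ length all
        len′ = subst₂ _≤_ (sym (length-map project ys)) all-length len

m+[n∸m]≡n+[m∸n] : ∀ m n → m + (n ∸ m) ≡ n + (m ∸ n)
m+[n∸m]≡n+[m∸n] m n with ≤-total m n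
... | inj₁ m≤n = trans (m+[n∸m]≡n m≤n) (sym (trans (cong (n +_) (m≤n⇒m∸n≡0 m≤n)) (+-identityʳ n)))
... | inj₂ n≤m = trans (cong (m +_) (m≤n⇒m∸n≡0 n≤m)) (trans (+-identityʳ m) (sym (m+[n∸m]≡n n≤m)))

module Zigzag {n′ : ℕ} (H : Graph (suc n′)) (F : LinearForest H) (b : ℕ) (components : length (paths F) ≡ suc b) where

  open Layered H

  p : ℕ
  p = edgesLF F

  p+b≡n′ : p + b ≡ n′
  p+b≡n′ = suc-injective (begin
    suc (p + b)                ≡⟨ sym (+-suc p b) ⟩
    p + suc b                  ≡⟨ cong (p +_) (sym components) ⟩
    p + length (paths F)       ≡⟨ pathEdges+length (nonempty F) ⟩
    length (concat (paths F))  ≡⟨ length-Spanning (spanning F) ⟩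
    suc n′                     ∎)
    where open ≡-Reasoning

  b≤n′ : b ≤ n′
  b≤n′ = subst (b ≤_) p+b≡n′ (m≤n+m b p)

  InLayer : ℕ → V → Set
  InLayer L v = layer v ≡ L

  tag : ℕ → List (Fin (suc n′)) → List V
  tag L = map (L ,_)

  All-tag : ∀ {P : V → Set} L hs → (∀ h → P (L , h)) → All P (tag L hs)
  All-tag L hs P-layer = Allₚ.map⁺ (All.universal (λ h → P-layer h) hs)

  tag-walk : ∀ L h hs → IsWalk (Adj H) (h ∷ hs) → ∃ λ h′ → Walk LexAdj (L , h) (L , h′) (tag L (h ∷ hs))
  tag-walk L h [] _ = h , [ L , h ]
  tag-walk L h (h₁ ∷ hs) (a ∷ w) with tag-walk L h₁ hs w
  ... | h′ , w′ = h′ , inj₂ (refl , a) ∷ w′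

  others : List (Fin (suc n′))
  others = tabulate Fin.suc

  length-others : length others ≡ n′
  length-others = length-tabulate Fin.suc

  pieces : ℕ → ℕ → List (List V)
  pieces L a = map (tag L) (splitPaths (a ∸ b) (paths F))

  concat-pieces : ∀ L a → concat (pieces L a) ≡ tag L (concat (paths F))
  concat-pieces L a = trans (concat-map (splitPaths (a ∸ b) (paths F))) (cong (tag L) (concat-splitPaths (a ∸ b) (paths F)))

  length-pieces : ∀ L {a} → a ≤ n′ → length (pieces L a) ≡ suc b + (a ∸ b)
  length-pieces L {a} a≤n′ =
    trans (length-map (tag L) (splitPaths (a ∸ b) (paths F)))
          (trans (length-splitPaths (a ∸ b) (nonempty F) a∸b≤p) (cong (_+ (a ∸ b)) components))
    where
    a∸b≤p : a ∸ b ≤ p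
    a∸b≤p = subst (a ∸ b ≤_) (m+n∸n≡m p b) (∸-monoˡ-≤ b (subst (a ≤_) (sym p+b≡n′) a≤n′))

  pieces-walk : ∀ L a → All (WalkBetween (InLayer L)) (pieces L a)
  pieces-walk L a = Allₚ.map⁺ (All.map piece-walk (All-splitPaths single tail (a ∸ b) (All.zip (nonempty F , walks F))))
    where
    Path : List (Fin (suc n′)) → Set
    Path hs = NonEmpty hs × IsWalk (Adj H) hs
    single : ∀ {h} → Path (h ∷ [])
    single {h} = (λ ()) , [ h ]
    tail : ∀ {h h′ hs} → Path (h ∷ h′ ∷ hs) → Path (h′ ∷ hs)
    tail (_ , _ ∷ w) = (λ ()) , w
    piece-walk : ∀ {hs} → Path hs → WalkBetween (InLayer L) (tag L hs)
    piece-walk {[]} (ne , _) = contradiction refl ne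
    piece-walk {h ∷ hs} (_ , w) with tag-walk L h hs w
    ... | h′ , w′ = (L , h) , (L , h′) , refl , refl , w′

  -- Layer L is cut into pieces separated by the
  -- leftover vertices R of layer L − 1 and, as far as these do not suffice, by vertices of layer L + 1;
  -- the walk then crosses to layer L + 2 through (L + 1, 0), with the unused vertices of layer L + 1 as
  -- its leftovers.
  zigzag : ℕ → ℕ → List V → List V
  zigzag zero L R = interleave (pieces L (length R)) R
  zigzag (suc i) L R =
    interleave (pieces L (length R)) (R ++ tag (suc L) (take c others))
      ++ (suc L , Fin.zero) ∷ zigzag i (suc (suc L)) (tag (suc L) (drop c others))
    where c = b ∸ length R

  length-tag-take : ∀ L a → length (tag L (take (b ∸ a) others)) ≡ b ∸ a
  length-tag-take L a = trans (length-map (L ,_) (take (b ∸ a) others)) (trans (length-take (b ∸ a) others)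
    (trans (cong ((b ∸ a) ⊓_) length-others) (m≤n⇒m⊓n≡m (≤-trans (m∸n≤m b a) b≤n′))))

  length-drop-others : ∀ L c → length (tag L (drop c others)) ≡ n′ ∸ c
  length-drop-others L c = trans (length-map (L ,_) (drop c others)) (trans (length-drop c others) (cong (_∸ c) length-others))

  piece-to-separator : ∀ {L u v} → InLayer L u → Consecutive L (layer v) → LexAdj u v
  piece-to-separator refl c = inj₁ c

  separator-to-piece : ∀ {L u v} → Consecutive L (layer u) → InLayer L v → LexAdj u v
  separator-to-piece c refl = inj₁ (Consecutive-sym c)

  leftover-bound : ∀ a q → b ≤ a + (p + q) → b ≤ n′ ∸ (b ∸ a) + q
  leftover-bound a q b≤ with ≤-total b a
  ... | inj₁ b≤a = ≤-trans b≤n′ (subst (λ c → n′ ≤ n′ ∸ c + q) (sym (m≤n⇒m∸n≡0 b≤a)) (m≤m+n n′ q))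
  ... | inj₂ a≤b = subst (λ m → b ≤ m + q) (sym n′∸[b∸a]≡p+a) (subst (b ≤_) (rearrange a p q) b≤)
    where
    n′∸[b∸a]≡p+a : n′ ∸ (b ∸ a) ≡ p + a
    n′∸[b∸a]≡p+a = trans (cong (_∸ (b ∸ a)) (sym p+b≡n′))
                         (trans (+-∸-assoc p (m∸n≤m b a)) (cong (p +_) (m∸[m∸n]≡n a≤b)))
    rearrange : ∀ a p q → a + (p + q) ≡ p + a + q
    rearrange = solve-∀

  -- Every layer needs at least b separators and can absorb p more by cutting, so the invariant
  -- b ≤ |R| + i p keeps the last layer from running short.
  zigzag-walk : ∀ i L R → All (Consecutive L ∘ layer) R → length R ≤ n′ → b ≤ length R + i * p →
                ∃₂ λ s e → InLayer L s × Walk LexAdj s e (zigzag i L R)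
  zigzag-walk zero L R separators R≤n′ b≤ with
    interleave-walk piece-to-separator separator-to-piece (pieces L (length R)) R (pieces-walk L (length R)) separators count
    where
    count : length (pieces L (length R)) ≡ suc (length R)
    count = trans (length-pieces L R≤n′) (cong suc (m+[n∸m]≡n (subst (b ≤_) (+-identityʳ (length R)) b≤)))
  ... | s , e , ps , _ , w = s , e , ps , w
  zigzag-walk (suc i) L R separators R≤n′ b≤ with
    interleave-walk piece-to-separator separator-to-piece (pieces L a) os (pieces-walk L a) os-separators count
    | zigzag-walk i (suc (suc L)) R′ (All-tag (suc L) (drop c others) (λ _ → inj₂ refl)) R′≤n′ b≤′
    where
    a = length R
    c = b ∸ a
    os = R ++ tag (suc L) (take c others)
    R′ = tag (suc L) (drop c others)
    os-separators : All (Consecutive L ∘ layer) os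
    os-separators = Allₚ.++⁺ separators (All-tag (suc L) (take c others) (λ _ → inj₁ refl))
    count : length (pieces L a) ≡ suc (length os)
    count = begin
      length (pieces L a)   ≡⟨ length-pieces L R≤n′ ⟩
      suc b + (a ∸ b)       ≡⟨ cong suc (m+[n∸m]≡n+[m∸n] b a) ⟩
      suc (a + c)           ≡⟨ cong (λ m → suc (a + m)) (sym (length-tag-take (suc L) a)) ⟩
      suc (a + length (tag (suc L) (take c others))) ≡⟨ cong suc (sym (length-++ R)) ⟩
      suc (length os)       ∎
      where open ≡-Reasoning
    R′≤n′ : length R′ ≤ n′
    R′≤n′ = subst (_≤ n′) (sym (length-drop-others (suc L) c)) (m∸n≤m n′ c)
    b≤′ : b ≤ length R′ + i * p
    b≤′ = subst (λ m → b ≤ m + i * p) (sym (length-drop-others (suc L) c)) (leftover-bound a (i * p) b≤)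
  ... | s , e , ps , pe , w | s′ , e′ , ps′ , w′ =
    s , e′ , ps , Walk-++ w (piece-to-separator pe (inj₁ refl)) (Walk-∷ (inj₁ (inj₁ ps′)) w′)

  All-pieces : ∀ {P : V → Set} L a → (∀ h → P (L , h)) → All P (concat (pieces L a))
  All-pieces L a P-layer = subst (All _) (sym (concat-pieces L a)) (All-tag L (concat (paths F)) P-layer)

  zigzag-bounded : ∀ i L R → All (λ v → layer v ≤ L) R → All (λ v → layer v ≤ L + 2 * i) (zigzag i L R)
  zigzag-bounded zero L R R≤L =
    All-interleave (pieces L (length R)) R (All-pieces L (length R) (λ _ → m≤m+n L 0))
                   (All.map (λ le → ≤-trans le (m≤m+n L 0)) R≤L)
  zigzag-bounded (suc i) L R R≤L =
    Allₚ.++⁺ (All-interleave (pieces L a) _ (All-pieces L a (λ _ → L≤top))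
                             (Allₚ.++⁺ (All.map (λ le → ≤-trans le L≤top) R≤L) (All-tag (suc L) (take c others) (λ _ → 1+L≤top))))
             (1+L≤top ∷ All.map (λ {v} le → subst (layer v ≤_) (2+m+2*n≡m+2*[1+n] L i) le)
                                (zigzag-bounded i (suc (suc L)) _ (All-tag (suc L) (drop c others) (λ _ → n≤1+n (suc L)))))
    where
    a = length R
    c = b ∸ a
    1+L≤top : suc L ≤ L + 2 * suc i
    1+L≤top = subst (suc L ≤_) (2+m+2*n≡m+2*[1+n] L i) (≤-trans (n≤1+n (suc L)) (m≤m+n (suc (suc L)) (2 * i)))
    L≤top : L ≤ L + 2 * suc i
    L≤top = ≤-trans (n≤1+n L) 1+L≤top

  zigzag-⊇ : ∀ i L R {x} → x ∈ R → x ∈ zigzag i L R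
  zigzag-⊇ zero L R x∈R = ∈-interleave⁺ʳ (pieces L (length R)) R x∈R
  zigzag-⊇ (suc i) L R x∈R = ∈-++⁺ˡ (∈-interleave⁺ʳ (pieces L (length R)) _ (∈-++⁺ˡ x∈R))

  ∈-pieces : ∀ L a h → (L , h) ∈ concat (pieces L a)
  ∈-pieces L a h = subst ((L , h) ∈_) (sym (concat-pieces L a)) (∈-map⁺ (L ,_) (proj₂ (spanning F) h))

  zigzag-covers : ∀ i L R d h → d ≤ 2 * i → (L + d , h) ∈ zigzag i L R
  zigzag-covers zero L R zero h _ =
    subst (λ l → (l , h) ∈ zigzag zero L R) (sym (+-identityʳ L)) (∈-interleave⁺ˡ (pieces L (length R)) R (∈-pieces L _ h))
  zigzag-covers (suc i) L R zero h _ =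
    subst (λ l → (l , h) ∈ zigzag (suc i) L R) (sym (+-identityʳ L))
          (∈-++⁺ˡ (∈-interleave⁺ˡ (pieces L (length R)) _ (∈-pieces L _ h)))
  zigzag-covers (suc i) L R (suc zero) h _ = subst (λ l → (l , h) ∈ zigzag (suc i) L R) (+-comm 1 L) (layer₁ h)
    where
    a = length R
    c = b ∸ a
    front = interleave (pieces L a) (R ++ tag (suc L) (take c others))
    layer₁ : ∀ h → (suc L , h) ∈ zigzag (suc i) L R
    layer₁ Fin.zero = ∈-++⁺ʳ front (here refl)
    layer₁ (Fin.suc h) with ∈-++⁻ (take c others) (subst (Fin.suc h ∈_) (sym (take++drop≡id c others)) (∈-tabulate⁺ h))
    ... | inj₁ taken = ∈-++⁺ˡ (∈-interleave⁺ʳ (pieces L a) _ (∈-++⁺ʳ R (∈-map⁺ (suc L ,_) taken)))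
    ... | inj₂ left = ∈-++⁺ʳ front (there (zigzag-⊇ i (suc (suc L)) _ (∈-map⁺ (suc L ,_) left)))
  zigzag-covers (suc i) L R (suc (suc d)) h d≤ =
    subst (λ l → (l , h) ∈ zigzag (suc i) L R) (2+m+n≡m+[2+n]) (∈-++⁺ʳ _ (there (zigzag-covers i (suc (suc L)) _ d h d≤2i)))
    where
    2+m+n≡m+[2+n] : suc (suc L) + d ≡ L + suc (suc d)
    2+m+n≡m+[2+n] = trans (sym (+-suc (suc L) d)) (sym (+-suc L (suc d)))
    d≤2i : d ≤ 2 * i
    d≤2i = ≤-pred (≤-pred (subst (suc (suc d) ≤_) (*-suc 2 i) d≤))

  length-concat-pieces : ∀ L a → length (concat (pieces L a)) ≡ suc n′
  length-concat-pieces L a = trans (cong length (concat-pieces L a))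
    (trans (length-map (L ,_) (concat (paths F))) (length-Spanning (spanning F)))

  zigzag-length : ∀ i L R → length (zigzag i L R) ≡ length R + suc n′ + i * (2 * suc n′)
  zigzag-length zero L R = begin
    length (interleave (pieces L (length R)) R)  ≡⟨ length-interleave (pieces L (length R)) R ⟩
    length (concat (pieces L (length R))) + length R ≡⟨ cong (_+ length R) (length-concat-pieces L (length R)) ⟩
    suc n′ + length R                             ≡⟨ +-comm (suc n′) (length R) ⟩
    length R + suc n′                             ≡⟨ sym (+-identityʳ _) ⟩
    length R + suc n′ + 0                         ∎
    where open ≡-Reasoning
  zigzag-length (suc i) L R = begin
    length (front ++ (suc L , Fin.zero) ∷ rest)
      ≡⟨ length-++ front ⟩
    length front + suc (length rest)
      ≡⟨ cong₂ (λ x y → x + suc y) length-front (zigzag-length i (suc (suc L)) R′) ⟩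
    suc n′ + (a + c) + suc (length R′ + suc n′ + i * (2 * suc n′))
      ≡⟨ cong (λ m → suc n′ + (a + c) + suc (m + suc n′ + i * (2 * suc n′))) (length-drop-others (suc L) c) ⟩
    suc n′ + (a + c) + suc (n′ ∸ c + suc n′ + i * (2 * suc n′))
      ≡⟨ arithmetic a c (n′ ∸ c) i (m+[n∸m]≡n (≤-trans (m∸n≤m b a) b≤n′)) ⟩
    a + suc n′ + suc i * (2 * suc n′)
      ∎
    where
    open ≡-Reasoning
    a = length R
    c = b ∸ a
    front = interleave (pieces L a) (R ++ tag (suc L) (take c others))
    R′ = tag (suc L) (drop c others)
    rest = zigzag i (suc (suc L)) R′
    length-front : length front ≡ suc n′ + (a + c)
    length-front = trans (length-interleave (pieces L a) _)
      (cong₂ _+_ (length-concat-pieces L a) (trans (length-++ R) (cong (a +_) (length-tag-take (suc L) a))))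
    arithmetic : ∀ a c d i {N} → c + d ≡ N →
                 suc N + (a + c) + suc (d + suc N + i * (2 * suc N)) ≡ a + suc N + (2 * suc N + i * (2 * suc N))
    arithmetic a c d i refl = identity a c d i
      where
      identity : ∀ a c d i → suc (c + d) + (a + c) + suc (d + suc (c + d) + i * (2 * suc (c + d)))
                           ≡ a + suc (c + d) + (2 * suc (c + d) + i * (2 * suc (c + d)))
      identity = solve-∀

  traceable : ∀ k → n′ ≤ suc k * p → TraceableRel (LexPathAdj (suc (2 * k)) H)
  traceable k n′≤ = StripWalk⇒traceable strip (≤-reflexive length-zigzag)
    where
    b≤kp : b ≤ 0 + k * p
    b≤kp = +-cancelˡ-≤ p b (k * p) (subst (_≤ suc k * p) (sym p+b≡n′) n′≤)
    strip : StripWalk (suc (2 * k)) (zigzag k 0 [])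
    strip = record
      { walk = Walk⇒IsWalk (proj₂ (proj₂ (proj₂ (zigzag-walk k 0 [] [] z≤n b≤kp))))
      ; bounded = All.map s≤s (zigzag-bounded k 0 [] [])
      ; covering = λ {l} h l<M → zigzag-covers k 0 [] l h (≤-pred l<M)
      }
    length-zigzag : length (zigzag k 0 []) ≡ suc (2 * k) * suc n′
    length-zigzag = trans (zigzag-length k 0 []) (arithmetic k (suc n′))
      where
      arithmetic : ∀ k N → 0 + N + k * (2 * N) ≡ suc (2 * k) * N
      arithmetic = solve-∀

forest⇒traceable : ∀ {n′} {H : Graph (suc n′)} (F : LinearForest H) k → n′ ≤ suc k * edgesLF F →
                    TraceableRel (LexPathAdj (suc (2 * k)) H)
forest⇒traceable {H = H} F k n′≤ = by-components (paths F) refl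
  where
  by-components : ∀ ps → paths F ≡ ps → TraceableRel (LexPathAdj (suc (2 * k)) H)
  by-components [] eq = contradiction (subst (λ ps → Fin.zero ∈ concat ps) eq (proj₂ (spanning F) Fin.zero)) λ ()
  by-components (_ ∷ qs) eq = Zigzag.traceable _ F (length qs) (cong length eq) k n′≤

theorem7 : (k : ℕ) → k ≥ 1 → (n : ℕ) → n ≥ 1 → (H : Graph n) → (p : ℕ) → IsPi H p →
    TraceableRel (LexPathAdj (2 * k + 1) H) ⇔ ((k + 1) * p ≥ order H ∸ 1)
theorem7 k _ zero () H p π
theorem7 k _ (suc n′) _ H p π@((F , edges≡p) , _) = mk⇔ necessary sufficient
  where
  open Layered H
  M≡ : 2 * k + 1 ≡ suc (2 * k)
  M≡ = +-comm (2 * k) 1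
  k+1≡ : k + 1 ≡ suc k
  k+1≡ = +-comm k 1
  necessary : TraceableRel (LexPathAdj (2 * k + 1) H) → n′ ≤ (k + 1) * p
  necessary traceable with traceable⇒StripWalk (subst (λ M → TraceableRel (LexPathAdj M H)) M≡ traceable)
  ... | _ , strip , unique = subst (λ m → n′ ≤ m * p) (sym k+1≡) (strip-necessity k π strip unique)
  sufficient : n′ ≤ (k + 1) * p → TraceableRel (LexPathAdj (2 * k + 1) H)
  sufficient n′≤ = subst (λ M → TraceableRel (LexPathAdj M H)) (sym M≡)
    (forest⇒traceable F k (subst (λ m → n′ ≤ suc k * m) (sym edges≡p) (subst (λ m → n′ ≤ m * p) k+1≡ n′≤)))
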